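{- Let $T$ be a consistent RE theory (in a language containing a constant $\mathbf{0}$ and a unary function symbol $\mathbf{S}$). If $T$ is RSS, then $T$ is RI.
   Context: $\overline{n}=\mathbf{S}^n\mathbf{0}$. $T$ is RSS if every recursive set $A\subseteq\mathbb{N}$ is strongly representable in $T$: there is a formula $\phi(x)$ with $n\in A\Rightarrow T\vdash\phi(\overline{n})$ and $n\notin A\Rightarrow T\vdash\neg\phi(\overline{n})$. With sentences identified with Gödel numbers, $T_P=\{\ulcorner\phi\urcorner:T\vdash\phi\}$, $T_R=\{\ulcorner\phi\urcorner:T\vdash\neg\phi\}$; $T$ is RI if there is no recursive set $X$ with $T_P\subseteq X$ and $X\cap T_R=\emptyset$. -}

module Defs where

open import Data.Nat using (ℕ; zero; suc; _+_; _*_; _∸_; _<_; _/_)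
open import Data.Fin using (Fin; toℕ)
import Data.Fin as Fin
open import Data.Vec using (Vec; []; _∷_; lookup)
open import Data.Product using (Σ; _×_; _,_)
open import Data.Sum using (_⊎_)
open import Data.Empty using (⊥)
open import Relation.Nullary using (¬_)
open import Relation.Binary.PropositionalEquality using (_≡_)

data PR : ℕ → Set where
  zeroF : ∀ {k} → PR k
  succF : PR 1
  projF : ∀ {k} → Fin k → PR k
  compF : ∀ {k m} → PR m → Vec (PR k) m → PR k
  recF  : ∀ {k} → PR k → PR (suc (suc k)) → PR (suc k)
  muF   : ∀ {k} → PR (suc k) → PR k

data _[_]⇓_ : ∀ {k} → PR k → Vec ℕ k → ℕ → Set
data _[_]⇓*_ : ∀ {k m} → Vec (PR k) m → Vec ℕ k → Vec ℕ m → Set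

data _[_]⇓_ where
  zero⇓ : ∀ {k} {xs : Vec ℕ k} → zeroF [ xs ]⇓ 0
  succ⇓ : ∀ {x} → succF [ x ∷ [] ]⇓ suc x
  proj⇓ : ∀ {k} {i : Fin k} {xs} → projF i [ xs ]⇓ lookup xs i
  comp⇓ : ∀ {k m} {f : PR m} {gs : Vec (PR k) m} {xs ys v} →
          gs [ xs ]⇓* ys → f [ ys ]⇓ v → compF f gs [ xs ]⇓ v
  rec0⇓ : ∀ {k} {f : PR k} {g xs v} →
          f [ xs ]⇓ v → recF f g [ 0 ∷ xs ]⇓ v
  recS⇓ : ∀ {k} {f : PR k} {g xs n u v} →
          recF f g [ n ∷ xs ]⇓ u → g [ n ∷ u ∷ xs ]⇓ v →
          recF f g [ suc n ∷ xs ]⇓ v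
  mu⇓   : ∀ {k} {f : PR (suc k)} {xs y} →
          f [ y ∷ xs ]⇓ 0 →
          ((z : ℕ) → z < y → Σ ℕ (λ v → f [ z ∷ xs ]⇓ suc v)) →
          muF f [ xs ]⇓ y

data _[_]⇓*_ where
  []⇓ : ∀ {k} {xs : Vec ℕ k} → [] [ xs ]⇓* []
  ∷⇓  : ∀ {k m} {g : PR k} {gs : Vec (PR k) m} {xs y ys} →
        g [ xs ]⇓ y → gs [ xs ]⇓* ys → (g ∷ gs) [ xs ]⇓* (y ∷ ys)

Recursive : (ℕ → Set) → Set
Recursive A = Σ (PR 1) λ e → (n : ℕ) → Σ ℕ λ v → (e [ n ∷ [] ]⇓ v) ×
                ((v ≡ 1 × A n) ⊎ (v ≡ 0 × ¬ A n))

RE : (ℕ → Set) → Set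
RE A = Σ (PR 1) λ e → (n : ℕ) →
         (A n → Σ ℕ λ v → e [ n ∷ [] ]⇓ v) × (Σ ℕ (λ v → e [ n ∷ [] ]⇓ v) → A n)

RecursiveFun : (ℕ → ℕ) → Set
RecursiveFun f = Σ (PR 1) λ e → (n : ℕ) → e [ n ∷ [] ]⇓ f n

-- funAr i = 0 : i is not a function symbol;  funAr i = suc a : i is a function
-- symbol of arity a.  Same for relation symbols.  (Equality is logical.)
record Language : Set where
  field
    funAr    : ℕ → ℕ
    relAr    : ℕ → ℕ
    funAr-rec : RecursiveFun funAr
    relAr-rec : RecursiveFun relAr
    zeroSym  : ℕ
    sucSym   : ℕ
    zeroSym-ar : funAr zeroSym ≡ 1
    sucSym-ar  : funAr sucSym ≡ 2

module Syntax (L : Language) where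
  open Language L

  -- terms and formulas with n free variables (de Bruijn indices)
  data Term (n : ℕ) : Set where
    var : Fin n → Term n
    app : (f : ℕ) {a : ℕ} → funAr f ≡ suc a → Vec (Term n) a → Term n

  data Formula (n : ℕ) : Set where
    ⊥'   : Formula n
    _≐_  : Term n → Term n → Formula n
    rel  : (r : ℕ) {a : ℕ} → relAr r ≡ suc a → Vec (Term n) a → Formula n
    _⇒_  : Formula n → Formula n → Formula n
    ∀'   : Formula (suc n) → Formula n

  infixr 5 _⇒_

  ¬' : ∀ {n} → Formula n → Formula n
  ¬' φ = φ ⇒ ⊥'

  Sentence : Set
  Sentence = Formula 0

  mutual
    renT : ∀ {n m} → (Fin n → Fin m) → Term n → Term m
    renT ρ (var i) = var (ρ i)
    renT ρ (app f p ts) = app f p (renTs ρ ts)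

    renTs : ∀ {n m a} → (Fin n → Fin m) → Vec (Term n) a → Vec (Term m) a
    renTs ρ [] = []
    renTs ρ (t ∷ ts) = renT ρ t ∷ renTs ρ ts

  lift : ∀ {n m} → (Fin n → Fin m) → Fin (suc n) → Fin (suc m)
  lift ρ Fin.zero = Fin.zero
  lift ρ (Fin.suc i) = Fin.suc (ρ i)

  ren : ∀ {n m} → (Fin n → Fin m) → Formula n → Formula m
  ren ρ ⊥' = ⊥'
  ren ρ (t ≐ s) = renT ρ t ≐ renT ρ s
  ren ρ (rel r p ts) = rel r p (renTs ρ ts)
  ren ρ (φ ⇒ ψ) = ren ρ φ ⇒ ren ρ ψ
  ren ρ (∀' φ) = ∀' (ren (lift ρ) φ)

  mutual
    subT : ∀ {n m} → (Fin n → Term m) → Term n → Term m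
    subT σ (var i) = σ i
    subT σ (app f p ts) = app f p (subTs σ ts)

    subTs : ∀ {n m a} → (Fin n → Term m) → Vec (Term n) a → Vec (Term m) a
    subTs σ [] = []
    subTs σ (t ∷ ts) = subT σ t ∷ subTs σ ts

  liftS : ∀ {n m} → (Fin n → Term m) → Fin (suc n) → Term (suc m)
  liftS σ Fin.zero = var Fin.zero
  liftS σ (Fin.suc i) = renT Fin.suc (σ i)

  sub : ∀ {n m} → (Fin n → Term m) → Formula n → Formula m
  sub σ ⊥' = ⊥'
  sub σ (t ≐ s) = subT σ t ≐ subT σ s
  sub σ (rel r p ts) = rel r p (subTs σ ts)
  sub σ (φ ⇒ ψ) = sub σ φ ⇒ sub σ ψ
  sub σ (∀' φ) = ∀' (sub (liftS σ) φ)

  _[_] : ∀ {n} → Formula (suc n) → Term n → Formula n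
  φ [ t ] = sub σ φ
    where
      σ : Fin (suc _) → Term _
      σ Fin.zero = t
      σ (Fin.suc i) = var i

  wk : ∀ {n} → Formula n → Formula (suc n)
  wk = ren Fin.suc

  close : ∀ {n} → Sentence → Formula n
  close = ren (λ ())

  num : ∀ {n} → ℕ → Term n
  num zero = app zeroSym zeroSym-ar []
  num (suc k) = app sucSym sucSym-ar (num k ∷ [])

  pair : ℕ → ℕ → ℕ
  pair a b = ((a + b) * suc (a + b)) / 2 + b

  mutual
    codeT : ∀ {n} → Term n → ℕ
    codeT (var i) = pair 0 (toℕ i)
    codeT (app f p ts) = pair 1 (pair f (codeTs ts))

    codeTs : ∀ {n a} → Vec (Term n) a → ℕ
    codeTs [] = 0
    codeTs (t ∷ ts) = suc (pair (codeT t) (codeTs ts))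

  ⌜_⌝ : ∀ {n} → Formula n → ℕ
  ⌜ ⊥' ⌝ = pair 0 0
  ⌜ t ≐ s ⌝ = pair 1 (pair (codeT t) (codeT s))
  ⌜ rel r p ts ⌝ = pair 2 (pair r (codeTs ts))
  ⌜ φ ⇒ ψ ⌝ = pair 3 (pair ⌜ φ ⌝ ⌜ ψ ⌝)
  ⌜ ∀' φ ⌝ = pair 4 ⌜ φ ⌝

  Theory : Set₁
  Theory = Sentence → Set

  data _⊢_ (T : Theory) : ∀ {n} → Formula n → Set where
    ax   : ∀ {n} {φ : Sentence} → T φ → T ⊢ close {n} φ
    axK  : ∀ {n} {φ ψ : Formula n} → T ⊢ (φ ⇒ ψ ⇒ φ)
    axS  : ∀ {n} {φ ψ χ : Formula n} →
           T ⊢ ((φ ⇒ ψ ⇒ χ) ⇒ (φ ⇒ ψ) ⇒ φ ⇒ χ)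
    axDN : ∀ {n} {φ : Formula n} → T ⊢ (¬' (¬' φ) ⇒ φ)
    mp   : ∀ {n} {φ ψ : Formula n} → T ⊢ (φ ⇒ ψ) → T ⊢ φ → T ⊢ ψ
    gen  : ∀ {n} {φ : Formula (suc n)} → T ⊢ φ → T ⊢ ∀' φ
    axInst : ∀ {n} {φ : Formula (suc n)} {t : Term n} → T ⊢ (∀' φ ⇒ φ [ t ])
    axDist : ∀ {n} {ψ : Formula n} {φ : Formula (suc n)} →
             T ⊢ (∀' (wk ψ ⇒ φ) ⇒ ψ ⇒ ∀' φ)
    axRefl : ∀ {n} {t : Term n} → T ⊢ (t ≐ t)
    axLeib : ∀ {n} {t s : Term n} {φ : Formula (suc n)} →
             T ⊢ ((t ≐ s) ⇒ φ [ t ] ⇒ φ [ s ])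

  Consistent : Theory → Set
  Consistent T = ¬ Σ Sentence λ φ → (T ⊢ φ) × (T ⊢ ¬' φ)

  RETheory : Theory → Set
  RETheory T = RE (λ k → Σ Sentence λ φ → (⌜ φ ⌝ ≡ k) × T φ)

  StronglyRepresents : Theory → Formula 1 → (ℕ → Set) → Set
  StronglyRepresents T φ A =
    ((n : ℕ) → A n → T ⊢ (φ [ num n ])) × ((n : ℕ) → ¬ A n → T ⊢ ¬' (φ [ num n ]))

  RSS : Theory → Set₁
  RSS T = (A : ℕ → Set) → Recursive A → Σ (Formula 1) λ φ → StronglyRepresents T φ A

  T-P : Theory → ℕ → Set
  T-P T k = Σ Sentence λ φ → (⌜ φ ⌝ ≡ k) × (T ⊢ φ)

  T-R : Theory → ℕ → Set
  T-R T k = Σ Sentence λ φ → (⌜ φ ⌝ ≡ k) × (T ⊢ ¬' φ)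

  RI : Theory → Set₁
  RI T = ¬ Σ (ℕ → Set) λ X → Recursive X ×
           ((k : ℕ) → T-P T k → X k) × ((k : ℕ) → X k → T-R T k → ⊥)

-- Suppose a recursive set X contained T_P and were disjoint from T_R. Write
-- ψ⟨d⟩ for the sentence ∀x (d̄ = x → ψ(x)), which T proves or refutes exactly
-- when it proves or refutes ψ(d̄), and whose Gödel number is a recursive
-- function of ⌜ψ⌝ and d. Then D = {n : ⌜φ⟨n⟩⌝ ∉ X, where ⌜φ⌝ = n} is
-- recursive, so strongly represented by some ψ; for d = ⌜ψ⌝, if d ∈ D then
-- ψ⟨d⟩ ∈ T_P ⊆ X, and if d ∉ D then ψ⟨d⟩ ∈ T_R yet ⌜ψ⟨d⟩⌝ ∈ X.
{-# OPTIONS --safe #-}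
module Submission where

open import Defs
open import Data.Nat using (ℕ; zero; suc; _+_; _*_; _/_)
open import Data.Nat.Properties using (*-distribʳ-+)
open import Data.Nat.DivMod using (m*n/n≡m)
open import Data.Nat.Tactic.RingSolver using (solve-∀)
open import Data.Fin using (Fin)
import Data.Fin as Fin
open import Data.Vec using (Vec; []; _∷_)
open import Data.Product using (Σ; _×_; _,_; proj₁; proj₂)
open import Data.Sum using (_⊎_; inj₁; inj₂)
open import Relation.Nullary using (¬_)
open import Relation.Binary.PropositionalEquality hiding ([_])

tri : ℕ → ℕ
tri zero = 0
tri (suc k) = suc k + tri k

tri[n]*2≡n*[1+n] : ∀ n → tri n * 2 ≡ n * suc n
tri[n]*2≡n*[1+n] zero = refl
tri[n]*2≡n*[1+n] (suc n) = begin
  (suc n + tri n) * 2        ≡⟨ *-distribʳ-+ 2 (suc n) (tri n) ⟩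
  suc n * 2 + tri n * 2      ≡⟨ cong (suc n * 2 +_) (tri[n]*2≡n*[1+n] n) ⟩
  suc n * 2 + n * suc n      ≡⟨ expand n ⟩
  suc n * suc (suc n)        ∎
  where
  open ≡-Reasoning
  expand : ∀ m → suc m * 2 + m * suc m ≡ suc m * suc (suc m)
  expand = solve-∀

n*[1+n]/2≡tri[n] : ∀ n → n * suc n / 2 ≡ tri n
n*[1+n]/2≡tri[n] n = trans (cong (_/ 2) (sym (tri[n]*2≡n*[1+n] n))) (m*n/n≡m (tri n) 2)

compF₁⇓ : ∀ {k} {f : PR 1} {g : PR k} {xs y v} →
          g [ xs ]⇓ y → f [ y ∷ [] ]⇓ v → compF f (g ∷ []) [ xs ]⇓ v
compF₁⇓ g f = comp⇓ (∷⇓ g []⇓) f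

compF₂⇓ : ∀ {k} {f : PR 2} {g h : PR k} {xs y z v} →
          g [ xs ]⇓ y → h [ xs ]⇓ z → f [ y ∷ z ∷ [] ]⇓ v →
          compF f (g ∷ h ∷ []) [ xs ]⇓ v
compF₂⇓ g h f = comp⇓ (∷⇓ g (∷⇓ h []⇓)) f

constF : ∀ {k} → ℕ → PR k
constF zero = zeroF
constF (suc c) = compF succF (constF c ∷ [])

constF⇓ : ∀ {k} (c : ℕ) {xs : Vec ℕ k} → constF c [ xs ]⇓ c
constF⇓ zero = zero⇓
constF⇓ (suc c) = compF₁⇓ (constF⇓ c) succ⇓

addF : PR 2
addF = recF (projF Fin.zero) (compF succF (projF (Fin.suc Fin.zero) ∷ []))

addF⇓ : ∀ m n → addF [ m ∷ n ∷ [] ]⇓ (m + n)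
addF⇓ zero n = rec0⇓ proj⇓
addF⇓ (suc m) n = recS⇓ (addF⇓ m n) (compF₁⇓ proj⇓ succ⇓)

triF : PR 1
triF = recF zeroF (compF addF (compF succF (projF Fin.zero ∷ []) ∷ projF (Fin.suc Fin.zero) ∷ []))

triF⇓ : ∀ n → triF [ n ∷ [] ]⇓ tri n
triF⇓ zero = rec0⇓ zero⇓
triF⇓ (suc n) = recS⇓ (triF⇓ n) (compF₂⇓ (compF₁⇓ proj⇓ succ⇓) proj⇓ (addF⇓ (suc n) (tri n)))

isZeroF : PR 1
isZeroF = recF (constF 1) zeroF

Recursive-¬ : ∀ {A : ℕ → Set} → Recursive A → Recursive (λ n → ¬ A n)
Recursive-¬ {A} (e , e-char) = compF isZeroF (e ∷ []) , λ n → negate (e-char n)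
  where
  negate : ∀ {n} → Σ ℕ (λ v → e [ n ∷ [] ]⇓ v × ((v ≡ 1 × A n) ⊎ (v ≡ 0 × ¬ A n))) →
           Σ ℕ λ v → compF isZeroF (e ∷ []) [ n ∷ [] ]⇓ v ×
                     ((v ≡ 1 × ¬ A n) ⊎ (v ≡ 0 × ¬ ¬ A n))
  negate (.1 , e⇓ , inj₁ (refl , a)) =
    0 , compF₁⇓ e⇓ (recS⇓ (rec0⇓ (constF⇓ 1)) zero⇓) , inj₂ (refl , λ ¬a → ¬a a)
  negate (.0 , e⇓ , inj₂ (refl , ¬a)) =
    1 , compF₁⇓ e⇓ (rec0⇓ (constF⇓ 1)) , inj₁ (refl , ¬a)

Recursive-∘ : ∀ {A : ℕ → Set} {f : ℕ → ℕ} → RecursiveFun f → Recursive A →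
              Recursive (λ n → A (f n))
Recursive-∘ {A} {f} (g , g⇓) (e , e-char) = compF e (g ∷ []) , char
  where
  char : ∀ n → Σ ℕ λ v → compF e (g ∷ []) [ n ∷ [] ]⇓ v ×
                         ((v ≡ 1 × A (f n)) ⊎ (v ≡ 0 × ¬ A (f n)))
  char n with e-char (f n)
  ... | v , e⇓ , holds = v , compF₁⇓ (g⇓ n) e⇓ , holds

module _ (L : Language) where
  open Language L
  open Syntax L

  Ren : ℕ → ℕ → Set
  Ren n m = Fin n → Fin m

  Subst : ℕ → ℕ → Set
  Subst n m = Fin n → Term m

  mutual
    renT-renT : ∀ {n m k} (ρ : Ren m k) (ρ′ : Ren n m) t →
                renT ρ (renT ρ′ t) ≡ renT (λ i → ρ (ρ′ i)) t
    renT-renT ρ ρ′ (var i) = refl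
    renT-renT ρ ρ′ (app f p ts) = cong (app f p) (renTs-renTs ρ ρ′ ts)

    renTs-renTs : ∀ {n m k a} (ρ : Ren m k) (ρ′ : Ren n m) (ts : Vec (Term n) a) →
                  renTs ρ (renTs ρ′ ts) ≡ renTs (λ i → ρ (ρ′ i)) ts
    renTs-renTs ρ ρ′ [] = refl
    renTs-renTs ρ ρ′ (t ∷ ts) = cong₂ _∷_ (renT-renT ρ ρ′ t) (renTs-renTs ρ ρ′ ts)

  mutual
    subT-cong : ∀ {n m} {σ σ′ : Subst n m} → (∀ i → σ i ≡ σ′ i) → ∀ t → subT σ t ≡ subT σ′ t
    subT-cong σ≗σ′ (var i) = σ≗σ′ i
    subT-cong σ≗σ′ (app f p ts) = cong (app f p) (subTs-cong σ≗σ′ ts)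

    subTs-cong : ∀ {n m a} {σ σ′ : Subst n m} → (∀ i → σ i ≡ σ′ i) → (ts : Vec (Term n) a) →
                 subTs σ ts ≡ subTs σ′ ts
    subTs-cong σ≗σ′ [] = refl
    subTs-cong σ≗σ′ (t ∷ ts) = cong₂ _∷_ (subT-cong σ≗σ′ t) (subTs-cong σ≗σ′ ts)

  mutual
    subT-renT : ∀ {n m k} (σ : Subst m k) (ρ : Ren n m) t →
                subT σ (renT ρ t) ≡ subT (λ i → σ (ρ i)) t
    subT-renT σ ρ (var i) = refl
    subT-renT σ ρ (app f p ts) = cong (app f p) (subTs-renTs σ ρ ts)

    subTs-renTs : ∀ {n m k a} (σ : Subst m k) (ρ : Ren n m) (ts : Vec (Term n) a) →
                  subTs σ (renTs ρ ts) ≡ subTs (λ i → σ (ρ i)) ts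
    subTs-renTs σ ρ [] = refl
    subTs-renTs σ ρ (t ∷ ts) = cong₂ _∷_ (subT-renT σ ρ t) (subTs-renTs σ ρ ts)

  mutual
    renT-subT : ∀ {n m k} (ρ : Ren m k) (σ : Subst n m) t →
                renT ρ (subT σ t) ≡ subT (λ i → renT ρ (σ i)) t
    renT-subT ρ σ (var i) = refl
    renT-subT ρ σ (app f p ts) = cong (app f p) (renTs-subTs ρ σ ts)

    renTs-subTs : ∀ {n m k a} (ρ : Ren m k) (σ : Subst n m) (ts : Vec (Term n) a) →
                  renTs ρ (subTs σ ts) ≡ subTs (λ i → renT ρ (σ i)) ts
    renTs-subTs ρ σ [] = refl
    renTs-subTs ρ σ (t ∷ ts) = cong₂ _∷_ (renT-subT ρ σ t) (renTs-subTs ρ σ ts)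

  mutual
    subT-var : ∀ {n} (t : Term n) → subT var t ≡ t
    subT-var (var i) = refl
    subT-var (app f p ts) = cong (app f p) (subTs-var ts)

    subTs-var : ∀ {n a} (ts : Vec (Term n) a) → subTs var ts ≡ ts
    subTs-var [] = refl
    subTs-var (t ∷ ts) = cong₂ _∷_ (subT-var t) (subTs-var ts)

  liftS-cong : ∀ {n m} {σ σ′ : Subst n m} → (∀ i → σ i ≡ σ′ i) →
               ∀ i → liftS σ i ≡ liftS σ′ i
  liftS-cong σ≗σ′ Fin.zero = refl
  liftS-cong σ≗σ′ (Fin.suc i) = cong (renT Fin.suc) (σ≗σ′ i)

  sub-cong : ∀ {n m} {σ σ′ : Subst n m} → (∀ i → σ i ≡ σ′ i) → ∀ φ → sub σ φ ≡ sub σ′ φ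
  sub-cong σ≗σ′ ⊥' = refl
  sub-cong σ≗σ′ (t ≐ s) = cong₂ _≐_ (subT-cong σ≗σ′ t) (subT-cong σ≗σ′ s)
  sub-cong σ≗σ′ (rel r p ts) = cong (rel r p) (subTs-cong σ≗σ′ ts)
  sub-cong σ≗σ′ (φ ⇒ ψ) = cong₂ _⇒_ (sub-cong σ≗σ′ φ) (sub-cong σ≗σ′ ψ)
  sub-cong σ≗σ′ (∀' φ) = cong ∀' (sub-cong (liftS-cong σ≗σ′) φ)

  sub-ren : ∀ {n m k} (σ : Subst m k) (ρ : Ren n m) φ → sub σ (ren ρ φ) ≡ sub (λ i → σ (ρ i)) φ
  sub-ren σ ρ ⊥' = refl
  sub-ren σ ρ (t ≐ s) = cong₂ _≐_ (subT-renT σ ρ t) (subT-renT σ ρ s)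
  sub-ren σ ρ (rel r p ts) = cong (rel r p) (subTs-renTs σ ρ ts)
  sub-ren σ ρ (φ ⇒ ψ) = cong₂ _⇒_ (sub-ren σ ρ φ) (sub-ren σ ρ ψ)
  sub-ren σ ρ (∀' φ) = cong ∀' (trans (sub-ren (liftS σ) (lift ρ) φ) (sub-cong lifted φ))
    where
    lifted : ∀ i → liftS σ (lift ρ i) ≡ liftS (λ j → σ (ρ j)) i
    lifted Fin.zero = refl
    lifted (Fin.suc i) = refl

  ren-sub : ∀ {n m k} (ρ : Ren m k) (σ : Subst n m) φ → ren ρ (sub σ φ) ≡ sub (λ i → renT ρ (σ i)) φ
  ren-sub ρ σ ⊥' = refl
  ren-sub ρ σ (t ≐ s) = cong₂ _≐_ (renT-subT ρ σ t) (renT-subT ρ σ s)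
  ren-sub ρ σ (rel r p ts) = cong (rel r p) (renTs-subTs ρ σ ts)
  ren-sub ρ σ (φ ⇒ ψ) = cong₂ _⇒_ (ren-sub ρ σ φ) (ren-sub ρ σ ψ)
  ren-sub ρ σ (∀' φ) = cong ∀' (trans (ren-sub (lift ρ) (liftS σ) φ) (sub-cong lifted φ))
    where
    lifted : ∀ i → renT (lift ρ) (liftS σ i) ≡ liftS (λ j → renT ρ (σ j)) i
    lifted Fin.zero = refl
    lifted (Fin.suc i) = trans (renT-renT (lift ρ) Fin.suc (σ i)) (sym (renT-renT Fin.suc ρ (σ i)))

  sub-id : ∀ {n} {σ : Subst n n} → (∀ i → σ i ≡ var i) → ∀ φ → sub σ φ ≡ φ
  sub-id σ≗var ⊥' = refl
  sub-id σ≗var (t ≐ s) =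
    cong₂ _≐_ (trans (subT-cong σ≗var t) (subT-var t)) (trans (subT-cong σ≗var s) (subT-var s))
  sub-id σ≗var (rel r p ts) = cong (rel r p) (trans (subTs-cong σ≗var ts) (subTs-var ts))
  sub-id σ≗var (φ ⇒ ψ) = cong₂ _⇒_ (sub-id σ≗var φ) (sub-id σ≗var ψ)
  sub-id {σ = σ} σ≗var (∀' φ) = cong ∀' (sub-id lifted φ)
    where
    lifted : ∀ i → liftS σ i ≡ var i
    lifted Fin.zero = refl
    lifted (Fin.suc i) = cong (renT Fin.suc) (σ≗var i)

  subT-num : ∀ {n m} (σ : Subst n m) d → subT σ (num d) ≡ num d
  subT-num σ zero = refl
  subT-num σ (suc d) = cong (λ t → app sucSym sucSym-ar (t ∷ [])) (subT-num σ d)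

  renT-num : ∀ {n m} (ρ : Ren n m) d → renT ρ (num d) ≡ num d
  renT-num ρ zero = refl
  renT-num ρ (suc d) = cong (λ t → app sucSym sucSym-ar (t ∷ [])) (renT-num ρ d)

  pairF : PR 2
  pairF = compF addF (compF triF (addF ∷ []) ∷ projF (Fin.suc Fin.zero) ∷ [])

  pairF⇓ : ∀ a b → pairF [ a ∷ b ∷ [] ]⇓ pair a b
  pairF⇓ a b = subst (pairF [ a ∷ b ∷ [] ]⇓_)
    (cong (_+ b) (sym (n*[1+n]/2≡tri[n] (a + b))))
    (compF₂⇓ (compF₁⇓ (addF⇓ a b) (triF⇓ (a + b))) proj⇓ (addF⇓ (tri (a + b)) b))

  pairOf : ∀ {k} → PR k → PR k → PR k
  pairOf g h = compF pairF (g ∷ h ∷ [])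

  pairOf⇓ : ∀ {k} {g h : PR k} {xs y z} →
            g [ xs ]⇓ y → h [ xs ]⇓ z → pairOf g h [ xs ]⇓ pair y z
  pairOf⇓ {y = y} {z} g⇓ h⇓ = compF₂⇓ g⇓ h⇓ (pairF⇓ y z)

  -- Numeral codes do not depend on the scope; scope 1 is the one of the numeral in instanceAt,
  -- which makes ⌜ instanceAt ψ d ⌝ ≡ instanceCode ⌜ ψ ⌝ d hold by refl.
  numCode : ℕ → ℕ
  numCode d = codeT (num {1} d)

  numCodeF : PR 1
  numCodeF = recF (pairOf (constF 1) (pairOf (constF zeroSym) (constF 0)))
                  (pairOf (constF 1) (pairOf (constF sucSym)
                    (compF succF (pairOf (projF (Fin.suc Fin.zero)) (constF 0) ∷ []))))

  numCodeF⇓ : ∀ d → numCodeF [ d ∷ [] ]⇓ numCode d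
  numCodeF⇓ zero = rec0⇓ (pairOf⇓ (constF⇓ 1) (pairOf⇓ (constF⇓ zeroSym) (constF⇓ 0)))
  numCodeF⇓ (suc d) = recS⇓ (numCodeF⇓ d)
    (pairOf⇓ (constF⇓ 1) (pairOf⇓ (constF⇓ sucSym) (compF₁⇓ (pairOf⇓ proj⇓ (constF⇓ 0)) succ⇓)))

  instanceAt : Formula 1 → ℕ → Sentence
  instanceAt ψ d = ∀' ((num d ≐ var Fin.zero) ⇒ ψ)

  instanceCode : ℕ → ℕ → ℕ
  instanceCode c d = pair 4 (pair 3 (pair (pair 1 (pair (numCode d) (pair 0 0))) c))

  instanceCodeF : PR 2
  instanceCodeF =
    pairOf (constF 4) (pairOf (constF 3)
      (pairOf (pairOf (constF 1) (pairOf (compF numCodeF (projF (Fin.suc Fin.zero) ∷ []))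
                                         (constF (pair 0 0))))
              (projF Fin.zero)))

  instanceCodeF⇓ : ∀ c d → instanceCodeF [ c ∷ d ∷ [] ]⇓ instanceCode c d
  instanceCodeF⇓ c d =
    pairOf⇓ (constF⇓ 4) (pairOf⇓ (constF⇓ 3)
      (pairOf⇓ (pairOf⇓ (constF⇓ 1) (pairOf⇓ (compF₁⇓ proj⇓ (numCodeF⇓ d)) (constF⇓ (pair 0 0))))
               proj⇓))

  diagonalCode : ℕ → ℕ
  diagonalCode n = instanceCode n n

  diagonalCode-recursive : RecursiveFun diagonalCode
  diagonalCode-recursive = compF instanceCodeF (projF Fin.zero ∷ projF Fin.zero ∷ []) ,
                           λ n → compF₂⇓ proj⇓ proj⇓ (instanceCodeF⇓ n n)

  module _ {T : Theory} where
    ⇒-trans : ∀ {n} {A B C : Formula n} → T ⊢ (A ⇒ B) → T ⊢ (B ⇒ C) → T ⊢ (A ⇒ C)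
    ⇒-trans ⊢A⇒B ⊢B⇒C = mp (mp axS (mp axK ⊢B⇒C)) ⊢A⇒B

    ⇒-flip : ∀ {n} {A B C : Formula n} → T ⊢ (A ⇒ B ⇒ C) → T ⊢ (B ⇒ A ⇒ C)
    ⇒-flip ⊢A⇒B⇒C = ⇒-trans axK (mp axS ⊢A⇒B⇒C)

    ⊢instanceAt : ∀ ψ d → T ⊢ (ψ [ num d ]) → T ⊢ instanceAt ψ d
    ⊢instanceAt ψ d ⊢ψd = mp (mp axDist (gen (⇒-flip leibniz))) ⊢ψd
      where
      ψ′ : Formula 2
      ψ′ = ren Fin.inject₁ ψ

      ψ′[x]≡ψ : ψ′ [ var Fin.zero ] ≡ ψ
      ψ′[x]≡ψ = trans (sub-ren _ Fin.inject₁ ψ) (sub-id (λ { Fin.zero → refl }) ψ)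

      ψ′[d]≡wk[ψd] : ψ′ [ num d ] ≡ wk (ψ [ num d ])
      ψ′[d]≡wk[ψd] = trans (sub-ren _ Fin.inject₁ ψ)
        (trans (sub-cong (λ { Fin.zero → sym (renT-num Fin.suc d) }) ψ) (sym (ren-sub Fin.suc _ ψ)))

      leibniz : T ⊢ ((num d ≐ var Fin.zero) ⇒ wk (ψ [ num d ]) ⇒ ψ)
      leibniz = subst₂ (λ A B → T ⊢ ((num d ≐ var Fin.zero) ⇒ A ⇒ B)) ψ′[d]≡wk[ψd] ψ′[x]≡ψ axLeib

    ⊢¬instanceAt : ∀ ψ d → T ⊢ ¬' (ψ [ num d ]) → T ⊢ ¬' (instanceAt ψ d)
    ⊢¬instanceAt ψ d ⊢¬ψd = ⇒-trans (mp (⇒-flip instantiate) axRefl) ⊢¬ψd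
      where
      instantiate : T ⊢ (instanceAt ψ d ⇒ (num d ≐ num d) ⇒ ψ [ num d ])
      instantiate = subst (λ t → T ⊢ (instanceAt ψ d ⇒ (t ≐ num d) ⇒ ψ [ num d ])) (subT-num _ d) axInst

  RSS⇒RI : (T : Theory) → RSS T → RI T
  RSS⇒RI T rss (X , X-recursive , T-P⊆X , X∩T-R=∅) =
    d∉X (T-P⊆X (diagonalCode d) (instanceAt ψ d , refl , ⊢ψ-at-d))
    where
    D : ℕ → Set
    D n = ¬ X (diagonalCode n)

    representation : Σ (Formula 1) λ ψ → StronglyRepresents T ψ D
    representation = rss D (Recursive-¬ (Recursive-∘ diagonalCode-recursive X-recursive))

    ψ : Formula 1
    ψ = proj₁ representation

    d : ℕ
    d = ⌜ ψ ⌝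

    ψ-represents-D : StronglyRepresents T ψ D
    ψ-represents-D = proj₂ representation

    d∉X : ¬ X (diagonalCode d)
    d∉X d∈X = X∩T-R=∅ (diagonalCode d) d∈X
      (instanceAt ψ d , refl , ⊢¬instanceAt ψ d (proj₂ ψ-represents-D d (λ ¬d∈X → ¬d∈X d∈X)))

    ⊢ψ-at-d : T ⊢ instanceAt ψ d
    ⊢ψ-at-d = ⊢instanceAt ψ d (proj₁ ψ-represents-D d d∉X)

theorem5p3 : (L : Language) → let open Syntax L in
    (T : Theory) → Consistent T → RETheory T → RSS T → RI T
theorem5p3 L T _ _ = RSS⇒RI L T
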